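{- For each $i \geq 2$ and $0 \leq j \leq i-1$, let $A_{i,j}$ and $B_{i,j}$ denote the sets of starting positions of occurrences of $T_{i-j}$ and $\overline{T_{i-j}}$ in $T_i$, respectively. Then $B_{i,0} = \emptyset$, $B_{i,1} = \{\tau_{i-1} + 1 \}$. For each $j \geq 2$, define \begin{align*} A_{i,j-1}'' &:= A_{i,j-1} \oplus \tau_{i-j}, \qquad B_{i,j-2}'' := B_{i,j-2} \oplus (\tau_{i-j} + \tau_{i-(j+1)}), \\ I_{i,j-3}' &:= \begin{cases} \emptyset, & j = 2, \\ A_{i, j-3}'' \cup B_{i, j-3}'', & j \geq 3, \text{ where} \end{cases} \\ B_{i, j-3}'' &:= B_{i,j-3} \oplus (\tau_{i-(j-1)} + \tau_{i-j}), \qquad A_{i, j-3}'' := A_{i,j-3} \oplus \tau_{i-(j-2)}. \end{align*} Then $B_{i,j} = B_{i,j-1} \cup A_{i,j-1}'' \cup B_{i,j-2}''$ with \[ B_{i,j-1} \cap A_{i,j-1}'' = I'_{i,j-3}, \quad B_{i,j-1} \cap B_{i,j-2}'' = \emptyset, \quad \text{and} \quad A_{i,j-1}'' \cap B_{i,j-2}'' = \emptyset. \]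
   Context: Strings are over $\{\texttt{a},\texttt{b}\}$. For a binary string $S$, $\overline{S}$ is obtained by swapping \texttt{a} and \texttt{b}. The Thue-Morse word is $T_1 := \texttt{a}$, $T_i := T_{i-1}\overline{T_{i-1}}$ for $i\ge 2$, and $\tau_i := |T_i| = 2^{i-1}$. For a set of integers $A$ and an integer $i$, $A \oplus i := \{a+i : a \in A\}$. -}

module Defs where

open import Data.Nat using (ℕ; zero; suc; _+_; _∸_; _^_)
open import Data.List using (List; []; _∷_; _++_; map; length)
open import Data.Product using (Σ; ∃; _×_)
open import Relation.Binary.PropositionalEquality using (_≡_)
open import Relation.Unary using (Pred)
open import Level using (0ℓ)
open import Data.Empty using (⊥)

data Letter : Set where
  a b : Letter

flip : Letter → Letter
flip a = b
flip b = a

bar : List Letter → List Letter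
bar = map flip

-- Thue–Morse words T_i for i ≥ 1 (T 0 is an unused dummy value)
T : ℕ → List Letter
T zero = []
T (suc zero) = a ∷ []
T (suc (suc n)) = T (suc n) ++ bar (T (suc n))

-- τ_i = |T_i| = 2^(i-1)   (only used for i ≥ 1)
τ : ℕ → ℕ
τ i = 2 ^ (i ∸ 1)

-- Occ u w p : p is a (1-indexed) starting position of an occurrence of u in w
Occ : List Letter → List Letter → Pred ℕ 0ℓ
Occ u w zero = ⊥
Occ u w (suc q) = Σ (List Letter) λ x → Σ (List Letter) λ y → length x ≡ q × w ≡ x ++ u ++ y

A : ℕ → ℕ → Pred ℕ 0ℓ
A i j = Occ (T (i ∸ j)) (T i)

B : ℕ → ℕ → Pred ℕ 0ℓ
B i j = Occ (bar (T (i ∸ j))) (T i)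

_⊕_ : Pred ℕ 0ℓ → ℕ → Pred ℕ 0ℓ
(X ⊕ k) p = ∃ λ x → X x × p ≡ x + k

-- Everything is read off the infinite Thue–Morse word t, of which T_k is the prefix of length τ_k: A_{i,j} and
-- B_{i,j} are the positions where the prefix of length τ_{i-j} of t, or its complement, fits into the prefix of
-- length τ_i. Since t (2n) = t n and t (2n + 1) differs from t n, occurrences of length at least 4 sit at even
-- positions and are exactly the doubles of the occurrences of half the length. So doubling all lengths and
-- positions carries the identities from i - j = 2 + n to i - j = 3 + n, and it remains to check them for i - j = 2,
-- by locating the pattern ba in t: every ba lies in baab, at offset 2 of abba, or at offset 3 of baababba, and an
-- abba followed two letters later by baab lies inside the image of ba or ab under three doublings.
module Submission where

open import Data.Empty using (⊥; ⊥-elim)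
open import Data.List using (List; []; _∷_; _++_; applyUpTo; length)
open import Data.List.Properties using (∷-injective; ∷-injectiveʳ; length-applyUpTo; map-applyUpTo)
open import Data.Nat
  using (ℕ; zero; suc; _+_; _*_; _∸_; _^_; _≤_; _<_; z≤n; s≤s; _≤?_; _<?_; ⌊_/2⌋; parity; NonZero)
open import Data.Nat.Properties
open import Data.Nat.Tactic.RingSolver using (solve-∀)
open import Data.Parity.Base as ℙ using (Parity; 0ℙ; 1ℙ)
open import Data.Parity.Properties using (+-homo-+; *-homo-*)
open import Data.Product using (∃-syntax; _×_; _,_; proj₁; proj₂)
open import Data.Sum using (inj₁; inj₂)
open import Function using (_∘_)
open import Level using (0ℓ)
open import Relation.Binary.Definitions using (DecidableEquality)
open import Relation.Binary.PropositionalEquality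
open import Relation.Nullary using (¬_; yes; no)
open import Relation.Nullary.Decidable using (Dec; map′; from-yes)
open import Relation.Unary using (Pred; _⊆_; _≐_; _∪_; _∩_; ∅; ｛_｝)
open import Relation.Unary.Algebra using (∪-cong; ∩-cong)
open import Relation.Unary.Properties using (≐-refl; ≐-sym; ≐-trans)

open import Defs

open ≡-Reasoning

flip-involutive : ∀ x → flip (flip x) ≡ x
flip-involutive a = refl
flip-involutive b = refl

flip-≢ : ∀ x → flip x ≢ x
flip-≢ a ()
flip-≢ b ()

_≟ₗ_ : DecidableEquality Letter
a ≟ₗ a = yes refl
a ≟ₗ b = no λ ()
b ≟ₗ a = no λ ()
b ≟ₗ b = yes refl

a≢b : a ≢ b
a≢b ()

flip-swap : ∀ {x y} → flip x ≡ y → x ≡ flip y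
flip-swap {x} refl = sym (flip-involutive x)

flipBy : Parity → Letter → Letter
flipBy 0ℙ x = x
flipBy 1ℙ x = flip x

flipBy-flip : ∀ p x → flipBy p (flip x) ≡ flip (flipBy p x)
flipBy-flip 0ℙ x = refl
flipBy-flip 1ℙ x = refl

flipBy-+ : ∀ p p′ x → flipBy p (flipBy p′ x) ≡ flipBy (p ℙ.+ p′) x
flipBy-+ 0ℙ p′ x = refl
flipBy-+ 1ℙ 0ℙ x = refl
flipBy-+ 1ℙ 1ℙ x = flip-involutive x

-- t n = a iff n has an even number of ones in binary. The first argument is fuel; any fuel ≥ n suffices.
thueMorse′ : ℕ → ℕ → Letter
thueMorse′ zero    n = a
thueMorse′ (suc k) n = flipBy (parity n) (thueMorse′ k ⌊ n /2⌋)

t : ℕ → Letter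
t n = thueMorse′ n n

thueMorse′-at-0 : ∀ k → thueMorse′ k 0 ≡ a
thueMorse′-at-0 zero    = refl
thueMorse′-at-0 (suc k) = thueMorse′-at-0 k

⌊n/2⌋≤pred : ∀ {n k} → n ≤ suc k → ⌊ n /2⌋ ≤ k
⌊n/2⌋≤pred {n} {k} n≤1+k = ≤-pred (≤-trans (s≤s (⌊n/2⌋-mono n≤1+k)) (⌊n/2⌋<n k))

thueMorse′-fuel : ∀ {k k′ n} → n ≤ k → n ≤ k′ → thueMorse′ k n ≡ thueMorse′ k′ n
thueMorse′-fuel {zero}  {k′}     z≤n _ = sym (thueMorse′-at-0 k′)
thueMorse′-fuel {suc k} {zero}   _ z≤n = thueMorse′-at-0 (suc k)
thueMorse′-fuel {suc k} {suc k′} {n} n≤k n≤k′ =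
  cong (flipBy (parity n)) (thueMorse′-fuel (⌊n/2⌋≤pred n≤k) (⌊n/2⌋≤pred n≤k′))

t-unfold : ∀ n → t n ≡ flipBy (parity n) (t ⌊ n /2⌋)
t-unfold zero    = refl
t-unfold (suc n) =
  cong (flipBy (parity (suc n))) (thueMorse′-fuel {n} (⌊n/2⌋≤pred ≤-refl) ≤-refl)

⌊2n/2⌋≡n : ∀ n → ⌊ 2 * n /2⌋ ≡ n
⌊2n/2⌋≡n zero    = refl
⌊2n/2⌋≡n (suc n) = trans (cong ⌊_/2⌋ (*-suc 2 n)) (cong suc (⌊2n/2⌋≡n n))

⌊1+2n/2⌋≡n : ∀ n → ⌊ 1 + 2 * n /2⌋ ≡ n
⌊1+2n/2⌋≡n zero    = refl
⌊1+2n/2⌋≡n (suc n) = trans (cong (⌊_/2⌋ ∘ suc) (*-suc 2 n)) (cong suc (⌊1+2n/2⌋≡n n))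

t-double : ∀ n → t (2 * n) ≡ t n
t-double n = trans (t-unfold (2 * n))
                   (cong₂ (λ p m → flipBy p (t m)) (*-homo-* 2 n) (⌊2n/2⌋≡n n))

t-double+1 : ∀ n → t (1 + 2 * n) ≡ flip (t n)
t-double+1 n = trans (t-unfold (1 + 2 * n))
                     (cong₂ (λ p m → flipBy p (t m)) parity-odd (⌊1+2n/2⌋≡n n))
  where
  parity-odd : parity (1 + 2 * n) ≡ 1ℙ
  parity-odd = trans (+-homo-+ 1 (2 * n)) (cong ℙ._⁻¹ (*-homo-* 2 n))

data EvenOdd : ℕ → Set where
  even : ∀ h → EvenOdd (2 * h)
  odd  : ∀ h → EvenOdd (1 + 2 * h)

evenOdd : ∀ n → EvenOdd n
evenOdd zero = even 0
evenOdd (suc n) with evenOdd n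
... | even h = odd h
... | odd h  = subst EvenOdd (*-suc 2 h) (even (suc h))

t-double-+ : ∀ q h → t (2 * q + 2 * h) ≡ t (q + h)
t-double-+ q h = trans (cong t (sym (*-distribˡ-+ 2 q h))) (t-double (q + h))

t-double-+1 : ∀ q h → t (2 * q + (1 + 2 * h)) ≡ flip (t (q + h))
t-double-+1 q h = trans (cong t position) (t-double+1 (q + h))
  where
  position : 2 * q + (1 + 2 * h) ≡ 1 + 2 * (q + h)
  position = trans (+-suc (2 * q) (2 * h)) (cong suc (sym (*-distribˡ-+ 2 q h)))

t-2+2n : ∀ n → t (2 + 2 * n) ≡ t (1 + n)
t-2+2n n = trans (cong t (sym (*-suc 2 n))) (t-double (1 + n))

record Occurrence (p : Parity) (L q : ℕ) : Set where
  constructor occurrence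
  field letter : ∀ r → r < L → t (q + r) ≡ flipBy p (t r)
open Occurrence public

letterAt : ∀ {p L q} → Occurrence p L q → ∀ r → r < L → ∀ {x} → x ≡ q + r → t x ≡ flipBy p (t r)
letterAt o r r<L refl = letter o r r<L

occurrence? : ∀ p L q → Dec (Occurrence p L q)
occurrence? p L q =
  map′ (λ all → occurrence λ r → all {r}) (λ o {r} → letter o r)
       (allUpTo? (λ r → t (q + r) ≟ₗ flipBy p (t r)) L)

occurrence₂ : ∀ {p q} → t q ≡ flipBy p a → t (1 + q) ≡ flipBy p b → Occurrence p 2 q
occurrence₂ {q = q} e₀ e₁ = occurrence λ where
  0 _ → trans (cong t (+-identityʳ q)) e₀
  1 _ → trans (cong t (+-comm q 1)) e₁
  (suc (suc r)) (s≤s (s≤s ()))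

letters₂ : ∀ {p q} → Occurrence p 2 q → t q ≡ flipBy p a × t (1 + q) ≡ flipBy p b
letters₂ {q = q} o = letterAt o 0 (s≤s z≤n) (sym (+-identityʳ q)) , letterAt o 1 (s≤s (s≤s z≤n)) (+-comm 1 q)

occurrence-prefix : ∀ {p L L′ q} → L′ ≤ L → Occurrence p L q → Occurrence p L′ q
occurrence-prefix L′≤L o = occurrence λ r r<L′ → letter o r (≤-trans r<L′ L′≤L)

occurrence-inside : ∀ {p p′ L L′ x o} → Occurrence p L x → Occurrence p′ L′ o → o + L′ ≤ L →
                    Occurrence (p ℙ.+ p′) L′ (x + o)
occurrence-inside {p} {p′} {x = x} {o} outer inner o+L′≤L = occurrence λ r r<L′ → begin
  t (x + o + r)              ≡⟨ cong t (+-assoc x o r) ⟩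
  t (x + (o + r))            ≡⟨ letter outer (o + r) (≤-trans (+-monoʳ-< o r<L′) o+L′≤L) ⟩
  flipBy p (t (o + r))       ≡⟨ cong (flipBy p) (letter inner r r<L′) ⟩
  flipBy p (flipBy p′ (t r)) ≡⟨ flipBy-+ p p′ (t r) ⟩
  flipBy (p ℙ.+ p′) (t r)    ∎

occurrence-double : ∀ {p L q} → Occurrence p L q → Occurrence p (2 * L) (2 * q)
occurrence-double {p} {L} {q} o = occurrence λ r → doubled r (evenOdd r)
  where
  doubled : ∀ r → EvenOdd r → r < 2 * L → t (2 * q + r) ≡ flipBy p (t r)
  doubled _ (even h) r<2L = begin
    t (2 * q + 2 * h)    ≡⟨ t-double-+ q h ⟩
    t (q + h)            ≡⟨ letter o h (*-cancelˡ-< 2 h L r<2L) ⟩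
    flipBy p (t h)       ≡⟨ cong (flipBy p) (t-double h) ⟨
    flipBy p (t (2 * h)) ∎
  doubled _ (odd h) r<2L = begin
    t (2 * q + (1 + 2 * h))  ≡⟨ t-double-+1 q h ⟩
    flip (t (q + h))         ≡⟨ cong flip (letter o h (*-cancelˡ-< 2 h L (<-trans (n<1+n _) r<2L))) ⟩
    flip (flipBy p (t h))    ≡⟨ flipBy-flip p (t h) ⟨
    flipBy p (flip (t h))    ≡⟨ cong (flipBy p) (t-double+1 h) ⟨
    flipBy p (t (1 + 2 * h)) ∎

occurrence-half : ∀ {p L q} → Occurrence p (2 * L) (2 * q) → Occurrence p L q
occurrence-half {p} {q = q} o = occurrence λ r r<L → begin
  t (q + r)            ≡⟨ t-double-+ q r ⟨
  t (2 * q + 2 * r)    ≡⟨ letter o (2 * r) (*-monoʳ-< 2 r<L) ⟩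
  flipBy p (t (2 * r)) ≡⟨ cong (flipBy p) (t-double r) ⟩
  flipBy p (t r)       ∎

-- Since t 1 = t 2, such an occurrence would put equal letters at 2m and 1 + 2m, for m = 1 + h.
¬occurrence-odd : ∀ {p L} h → 2 ≤ L → ¬ Occurrence p (2 * L) (1 + 2 * h)
¬occurrence-odd {p} {L} h 2≤L o = flip-≢ (t (1 + h)) (begin
  flip (t (1 + h))     ≡⟨ t-double+1 (1 + h) ⟨
  t (1 + 2 * (1 + h))  ≡⟨ letterAt o 2 2<2L (sym (shift 1)) ⟩
  flipBy p b           ≡⟨ letterAt o 1 (<-trans (n<1+n 1) 2<2L) (sym (shift 0)) ⟨
  t (2 * (1 + h))      ≡⟨ t-double (1 + h) ⟩
  t (1 + h)            ∎)
  where
  2<2L : 2 < 2 * L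
  2<2L = ≤-trans (n≤1+n 3) (*-monoʳ-≤ 2 2≤L)
  shift : ∀ k → 1 + 2 * h + (1 + k) ≡ k + 2 * (1 + h)
  shift k = trans (+-suc (1 + 2 * h) k) (trans (cong (_+ k) (sym (*-suc 2 h))) (+-comm (2 * (1 + h)) k))

occurrence-2^ : ∀ n → Occurrence 1ℙ (2 ^ n) (2 ^ n)
occurrence-2^ zero    = occurrence λ where
  zero _ → refl
  (suc r) (s≤s ())
occurrence-2^ (suc n) = occurrence-double (occurrence-2^ n)

occurrences-agree : ∀ {p p′ L L′ x y} → Occurrence p L x → Occurrence p′ L′ y →
                    ∀ r r′ → r < L → r′ < L′ → x + r ≡ y + r′ → flipBy p (t r) ≡ flipBy p′ (t r′)
occurrences-agree o o′ r r′ r<L r′<L′ e = trans (sym (letter o r r<L)) (letterAt o′ r′ r′<L′ e)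

t-2^ : ∀ n → t (2 ^ n) ≡ b
t-2^ n = letterAt (occurrence-2^ n) 0 (m^n>0 2 n) (sym (+-identityʳ (2 ^ n)))

-- Squares start at odd positions, since t (2h) and t (1 + 2h) always differ.
t-square : ∀ {p x} → t x ≡ flipBy p b → t (1 + x) ≡ flipBy p b → ∃[ y ] x ≡ 1 + 2 * y × Occurrence p 2 y
t-square {p} {x} e₀ e₁ with evenOdd x
... | even h = ⊥-elim (flip-≢ (t h) (begin
  flip (t h)      ≡⟨ t-double+1 h ⟨
  t (1 + 2 * h)   ≡⟨ e₁ ⟩
  flipBy p b      ≡⟨ e₀ ⟨
  t (2 * h)       ≡⟨ t-double h ⟩
  t h             ∎))
... | odd y  = y , refl , occurrence₂ (trans (flip-swap (trans (sym (t-double+1 y)) e₀)) (sym (flipBy-flip p b)))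
                                      (trans (sym (t-2+2n y)) e₁)

complement-position : ∀ n {q} → q ≤ 2 ^ n → Occurrence 1ℙ (2 ^ n) q → q ≡ 2 ^ n
complement-position zero          z≤n             o = ⊥-elim (a≢b (letter o 0 (s≤s z≤n)))
complement-position zero          (s≤s z≤n)       _ = refl
complement-position (suc zero)    z≤n             o = ⊥-elim (a≢b (letter o 0 (s≤s z≤n)))
complement-position (suc zero)    (s≤s z≤n)       o = ⊥-elim (a≢b (sym (letter o 1 (s≤s (s≤s z≤n)))))
complement-position (suc zero)    (s≤s (s≤s z≤n)) _ = refl
complement-position (suc (suc n)) {q} q≤2^n o = at (evenOdd q) q≤2^n o (complement-position (suc n))
  where
  at : ∀ {q} → EvenOdd q → q ≤ 2 ^ (2 + n) → Occurrence 1ℙ (2 ^ (2 + n)) q →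
       (∀ {v} → v ≤ 2 ^ (1 + n) → Occurrence 1ℙ (2 ^ (1 + n)) v → v ≡ 2 ^ (1 + n)) → q ≡ 2 ^ (2 + n)
  at (even v) q≤2^n o halved = cong (2 *_) (halved (*-cancelˡ-≤ 2 q≤2^n) (occurrence-half {q = v} o))
  at (odd h)  _     o _      = ⊥-elim (¬occurrence-odd h (*-monoʳ-≤ 2 (m^n>0 2 n)) o)

⊕-cong : ∀ {X Y s} → X ≐ Y → (X ⊕ s) ≐ (Y ⊕ s)
⊕-cong (X⊆Y , Y⊆X) = (λ (x , x∈X , e) → x , X⊆Y x∈X , e) , (λ (x , x∈Y , e) → x , Y⊆X x∈Y , e)

⊕-≡ : ∀ {X m n} → m ≡ n → (X ⊕ m) ≐ (X ⊕ n)
⊕-≡ refl = ≐-refl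

⊕-mono : ∀ {X Y s} → X ⊆ Y → (X ⊕ s) ⊆ (Y ⊕ s)
⊕-mono X⊆Y (x , x∈X , e) = x , X⊆Y x∈X , e

⊕-+ : ∀ {X m n} → (X ⊕ (m + n)) ⊆ ((X ⊕ m) ⊕ n)
⊕-+ {m = m} {n} (x , x∈X , refl) = x + m , (x , x∈X , refl) , sym (+-assoc x m n)

-- Positions are 1-indexed as in Occ: the occurrence at 0-indexed q is recorded as suc q.
Occurrences : Parity → ℕ → ℕ → Pred ℕ 0ℓ
Occurrences p L M zero    = ⊥
Occurrences p L M (suc q) = q + L ≤ M × Occurrence p L q

Occurrences-prefix : ∀ {p L L′ M} → L′ ≤ L → Occurrences p L M ⊆ Occurrences p L′ M
Occurrences-prefix _    {zero}  ()
Occurrences-prefix L′≤L {suc q} (fits , o) = ≤-trans (+-monoʳ-≤ q L′≤L) fits , occurrence-prefix L′≤L o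

Occurrences-inside : ∀ {p p′ L L′ M o} → Occurrence p′ L′ o → o + L′ ≤ L →
                     (Occurrences p L M ⊕ o) ⊆ Occurrences (p ℙ.+ p′) L′ M
Occurrences-inside _ _ (zero , () , _)
Occurrences-inside {L′ = L′} {o = o} inner o+L′≤L (suc x , (fits , outer) , refl) =
  ≤-trans (≤-reflexive (+-assoc x o L′)) (≤-trans (+-monoʳ-≤ x o+L′≤L) fits) ,
  occurrence-inside outer inner o+L′≤L

Occurrences-too-long : ∀ {p L M} → M < L → Occurrences p L M ≐ ∅
Occurrences-too-long {L = L} M<L = (λ { {suc q} (fits , _) → <⇒≱ M<L (≤-trans (m≤n+m L q) fits) }) , λ ()

Occurrences-whole : ∀ {L} → 0 < L → Occurrences 1ℙ L L ≐ ∅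
Occurrences-whole {L} 0<L = whole , λ ()
  where
  whole : ∀ {p} → Occurrences 1ℙ L L p → ⊥
  whole {suc zero}    (_ , o)    = a≢b (letter o 0 0<L)
  whole {suc (suc q)} (fits , _) = <-irrefl refl (≤-trans (s≤s (m≤n+m L q)) fits)

Occurrences-middle : ∀ n → Occurrences 1ℙ (2 ^ n) (2 * 2 ^ n) ≐ ｛ 2 ^ n + 1 ｝
Occurrences-middle n = to , from
  where
  N : ℕ
  N = 2 ^ n
  N+N≡2N : N + N ≡ 2 * N
  N+N≡2N = cong (N +_) (sym (+-identityʳ N))
  to : Occurrences 1ℙ N (2 * N) ⊆ ｛ N + 1 ｝
  to {suc q} (fits , o) =
    trans (+-comm N 1) (cong suc (sym (complement-position n q≤N o)))
    where
    q≤N : q ≤ N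
    q≤N = +-cancelʳ-≤ N q N (subst (q + N ≤_) (sym N+N≡2N) fits)
  from : ｛ N + 1 ｝ ⊆ Occurrences 1ℙ N (2 * N)
  from refl = subst (Occurrences 1ℙ N (2 * N)) (+-comm 1 N) (≤-reflexive N+N≡2N , occurrence-2^ n)

-- Doubling of 0-indexed positions; on 1-indexed positions it is p ↦ 2p − 1.
data Doubled (X : Pred ℕ 0ℓ) : Pred ℕ 0ℓ where
  double : ∀ {q} → X (suc q) → Doubled X (suc (2 * q))

undouble : ∀ {X p q} → Doubled X p → p ≡ suc (2 * q) → X (suc q)
undouble {X} (double {q′} q′∈X) e = subst (X ∘ suc) (*-cancelˡ-≡ q′ _ 2 (suc-injective e)) q′∈X

Doubled-cong : ∀ {X Y} → X ≐ Y → Doubled X ≐ Doubled Y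
Doubled-cong (X⊆Y , Y⊆X) = (λ { (double q∈X) → double (X⊆Y q∈X) })
                         , (λ { (double q∈Y) → double (Y⊆X q∈Y) })

Doubled-∅ : Doubled ∅ ≐ ∅
Doubled-∅ = (λ { (double ()) }) , λ ()

Doubled-∪ : ∀ {X Y} → Doubled (X ∪ Y) ≐ (Doubled X ∪ Doubled Y)
Doubled-∪ = (λ where (double (inj₁ q∈X)) → inj₁ (double q∈X)
                     (double (inj₂ q∈Y)) → inj₂ (double q∈Y))
          , (λ where (inj₁ (double q∈X)) → double (inj₁ q∈X)
                     (inj₂ (double q∈Y)) → double (inj₂ q∈Y))

Doubled-∩ : ∀ {X Y} → Doubled (X ∩ Y) ≐ (Doubled X ∩ Doubled Y)
Doubled-∩ = (λ { (double (q∈X , q∈Y)) → double q∈X , double q∈Y })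
          , (λ { (double q∈X , p∈DY) → double (q∈X , undouble p∈DY refl) })

Doubled-⊕ : ∀ {X s} → ¬ X 0 → Doubled (X ⊕ s) ≐ (Doubled X ⊕ (2 * s))
Doubled-⊕ {X} {s} 0∉X = to , from
  where
  to : Doubled (X ⊕ s) ⊆ (Doubled X ⊕ (2 * s))
  to (double (zero , 0∈X , _)) = ⊥-elim (0∉X 0∈X)
  to (double (suc x , x∈X , refl)) = suc (2 * x) , double x∈X , cong suc (*-distribˡ-+ 2 x s)
  from : (Doubled X ⊕ (2 * s)) ⊆ Doubled (X ⊕ s)
  from (_ , double {x} x∈X , refl) =
    subst (Doubled (X ⊕ s)) (cong suc (*-distribˡ-+ 2 x s)) (double (suc x , x∈X , refl))

Occurrences-double : ∀ {p L M} → 2 ≤ L → Occurrences p (2 * L) (2 * M) ≐ Doubled (Occurrences p L M)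
Occurrences-double {p} {L} {M} 2≤L = to , from
  where
  to : Occurrences p (2 * L) (2 * M) ⊆ Doubled (Occurrences p L M)
  to {zero} ()
  to {suc q} (fits , o) with evenOdd q
  ... | even v = double {q = v} (*-cancelˡ-≤ 2 (subst (_≤ 2 * M) (sym (*-distribˡ-+ 2 v L)) fits) , occurrence-half o)
  ... | odd h  = ⊥-elim (¬occurrence-odd h 2≤L o)
  from : Doubled (Occurrences p L M) ⊆ Occurrences p (2 * L) (2 * M)
  from (double {v} (fits , o)) = subst (_≤ 2 * M) (*-distribˡ-+ 2 v L) (*-monoʳ-≤ 2 fits) , occurrence-double o

-- The recurrence and its invariance under doubling

-- O p d plays A_{i,j-d} (p = 0ℙ) or B_{i,j-d} (p = 1ℙ), I plays I'_{i,j-3}, and s₁, s₂ are the shifts of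
-- A''_{i,j-1} and B''_{i,j-2}.
record Recurrence (O : Parity → ℕ → Pred ℕ 0ℓ) (I : Pred ℕ 0ℓ) (s₁ s₂ : ℕ) : Set where
  field
    union        : O 1ℙ 0 ≐ ((O 1ℙ 1 ∪ (O 0ℙ 1 ⊕ s₁)) ∪ (O 1ℙ 2 ⊕ s₂))
    intersection : (O 1ℙ 1 ∩ (O 0ℙ 1 ⊕ s₁)) ≐ I
    disjoint₁    : (O 1ℙ 1 ∩ (O 1ℙ 2 ⊕ s₂)) ≐ ∅
    disjoint₂    : ((O 0ℙ 1 ⊕ s₁) ∩ (O 1ℙ 2 ⊕ s₂)) ≐ ∅

Recurrence-cong : ∀ {O O′ I I′ s₁ s₂} → (∀ p d → d ≤ 2 → O p d ≐ O′ p d) → I ≐ I′ →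
                  Recurrence O I s₁ s₂ → Recurrence O′ I′ s₁ s₂
Recurrence-cong {O} {O′} {s₁ = s₁} {s₂} O≐O′ I≐I′ R = record
  { union        = ≐-trans (≐-sym (O≐O′ 1ℙ 0 z≤n)) (≐-trans union (∪-cong (∪-cong B₁ A₁) B₂))
  ; intersection = ≐-trans (≐-sym (∩-cong B₁ A₁)) (≐-trans intersection I≐I′)
  ; disjoint₁    = ≐-trans (≐-sym (∩-cong B₁ B₂)) disjoint₁
  ; disjoint₂    = ≐-trans (≐-sym (∩-cong A₁ B₂)) disjoint₂
  }
  where
  open Recurrence R
  B₁ : O 1ℙ 1 ≐ O′ 1ℙ 1
  B₁ = O≐O′ 1ℙ 1 (s≤s z≤n)
  A₁ : (O 0ℙ 1 ⊕ s₁) ≐ (O′ 0ℙ 1 ⊕ s₁)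
  A₁ = ⊕-cong (O≐O′ 0ℙ 1 (s≤s z≤n))
  B₂ : (O 1ℙ 2 ⊕ s₂) ≐ (O′ 1ℙ 2 ⊕ s₂)
  B₂ = ⊕-cong (O≐O′ 1ℙ 2 (s≤s (s≤s z≤n)))

Recurrence-Doubled : ∀ {O I s₁ s₂} → (∀ p d → ¬ O p d 0) → Recurrence O I s₁ s₂ →
                     Recurrence (λ p d → Doubled (O p d)) (Doubled I) (2 * s₁) (2 * s₂)
Recurrence-Doubled {O} {I} {s₁} {s₂} 0∉O R = record
  { union        = ≐-trans (Doubled-cong union)
                           (≐-trans Doubled-∪ (∪-cong (≐-trans Doubled-∪ (∪-cong ≐-refl A₁)) B₂))
  ; intersection = ≐-trans (≐-sym (≐-trans Doubled-∩ (∩-cong ≐-refl A₁))) (Doubled-cong intersection)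
  ; disjoint₁    = ≐-trans (≐-sym (≐-trans Doubled-∩ (∩-cong ≐-refl B₂)))
                           (≐-trans (Doubled-cong disjoint₁) Doubled-∅)
  ; disjoint₂    = ≐-trans (≐-sym (≐-trans Doubled-∩ (∩-cong A₁ B₂)))
                           (≐-trans (Doubled-cong disjoint₂) Doubled-∅)
  }
  where
  open Recurrence R
  A₁ : Doubled (O 0ℙ 1 ⊕ s₁) ≐ (Doubled (O 0ℙ 1) ⊕ (2 * s₁))
  A₁ = Doubled-⊕ (0∉O 0ℙ 1)
  B₂ : Doubled (O 1ℙ 2 ⊕ s₂) ≐ (Doubled (O 1ℙ 2) ⊕ (2 * s₂))
  B₂ = Doubled-⊕ (0∉O 1ℙ 2)

-- The smallest scale: occurrences of ba

round-up : ∀ k {y m r} .{{_ : NonZero k}} → k * y + suc r ≤ k * m → k * y + k ≤ k * m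
round-up k {y} {m} fits =
  subst (_≤ k * m) (trans (*-suc k y) (+-comm k (k * y)))
        (*-monoʳ-≤ k (*-cancelˡ-< k y m (<-≤-trans (m<m+n (k * y) (s≤s z≤n)) fits)))

-- The three ways an occurrence of ba sits in t: in baab (ba doubled), at offset 2 in abba (a doubled
-- twice), or at offset 3 in baababba (ba doubled twice).
data BaPosition : ℕ → Set where
  in-baab     : ∀ v → Occurrence 1ℙ 2 v → BaPosition (2 * v)
  in-abba     : ∀ y → Occurrence 0ℙ 1 y → BaPosition (2 * (2 * y) + 2)
  in-baababba : ∀ y → Occurrence 1ℙ 2 y → BaPosition (2 * (2 * y) + 3)

ba-position : ∀ {q} → Occurrence 1ℙ 2 q → BaPosition q
ba-position {q} o with evenOdd q | letters₂ o
... | even v | t2v , _ = at-even v (trans (sym (t-double v)) t2v)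
  where
  at-even : ∀ w → t w ≡ b → BaPosition (2 * w)
  at-even w tw with t (1 + w) in t1+w
  ... | a = in-baab w (occurrence₂ tw t1+w)
  ... | b with t-square {0ℙ} {w} tw t1+w
  ...   | y , refl , ab = subst BaPosition (position y) (in-abba y (occurrence-prefix (s≤s z≤n) ab))
    where
    position : ∀ y → 2 * (2 * y) + 2 ≡ 2 * (1 + 2 * y)
    position = solve-∀
... | odd v  | t1+2v , t2+2v
  with t-square {1ℙ} {v} (flip-swap (trans (sym (t-double+1 v)) t1+2v)) (trans (sym (t-2+2n v)) t2+2v)
...   | y , refl , ba = subst BaPosition (position y) (in-baababba y ba)
  where
  position : ∀ y → 2 * (2 * y) + 3 ≡ 1 + 2 * (1 + 2 * y)
  position = solve-∀

-- The two ways abba at x and baab at x + 2 overlap in t: inside ba or inside ab, doubled three times.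
data AbbaBaabPosition : ℕ → Set where
  in-complemented : ∀ y → Occurrence 1ℙ 2 y → AbbaBaabPosition (2 * (2 * (2 * y)) + 4)
  in-plain        : ∀ y → Occurrence 0ℙ 2 y → AbbaBaabPosition (2 * (2 * (2 * y)) + 6)

abba-baab-position : ∀ {x} → Occurrence 0ℙ 4 x → Occurrence 1ℙ 4 (x + 2) → AbbaBaabPosition x
abba-baab-position {x} abba baab
  with t-square {0ℙ} {1 + x} (letterAt abba 1 (from-yes (1 <? 4)) (+-comm 1 x))
                             (letterAt abba 2 (from-yes (2 <? 4)) (+-comm 2 x))
... | v , refl , ab =
  at-ab v ab (trans (sym (t-double (2 + v))) (letterAt baab 2 (from-yes (2 <? 4)) (sym (position v))))
  where
  position : ∀ v → 2 * v + 2 + 2 ≡ 2 * (2 + v)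
  position = solve-∀
  at-ab : ∀ w → Occurrence 0ℙ 2 w → t (2 + w) ≡ a → AbbaBaabPosition (2 * w)
  at-ab w ab t2+w with evenOdd w | letters₂ ab
  ... | even h | t2h , _
    with t-square {1ℙ} {h} (trans (sym (t-double h)) t2h) (trans (sym (t-2+2n h)) t2+w)
  ...   | y , refl , ba = subst AbbaBaabPosition (position₁ y) (in-complemented y ba)
    where
    position₁ : ∀ y → 2 * (2 * (2 * y)) + 4 ≡ 2 * (2 * (1 + 2 * y))
    position₁ = solve-∀
  at-ab w ab t2+w | odd h | t1+2h , t2+2h
    with t-square {0ℙ} {h} (flip-swap (trans (sym (t-double+1 h)) t1+2h)) (trans (sym (t-2+2n h)) t2+2h)
  ...   | y , refl , ab′ = subst AbbaBaabPosition (position₂ y) (in-plain y ab′)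
    where
    position₂ : ∀ y → 2 * (2 * (2 * y)) + 6 ≡ 2 * (1 + 2 * (1 + 2 * y))
    position₂ = solve-∀

ba-⊇ : ∀ {M} → ((Occurrences 1ℙ 4 M ∪ (Occurrences 0ℙ 4 M ⊕ 2)) ∪ (Occurrences 1ℙ 8 M ⊕ 3)) ⊆
               Occurrences 1ℙ 2 M
ba-⊇ (inj₁ (inj₁ p∈baab)) = Occurrences-prefix (from-yes (2 ≤? 4)) p∈baab
ba-⊇ (inj₁ (inj₂ p∈abba)) = Occurrences-inside (from-yes (occurrence? 1ℙ 2 2)) ≤-refl p∈abba
ba-⊇ (inj₂ p∈baababba)    = Occurrences-inside (from-yes (occurrence? 0ℙ 2 3)) (from-yes (5 ≤? 8)) p∈baababba

fits-8 : ∀ {y m} → 2 * (2 * y) + 3 + 2 ≤ 2 * (2 * (2 * m)) → 2 * (2 * y) + 8 ≤ 2 * (2 * (2 * m))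
fits-8 {y} {m} fits =
  subst₂ _≤_ (e₃ y) (sym (e₂ m)) (round-up 4 {1 + y} {2 * m} (subst₂ _≤_ (e₁ y) (e₂ m) fits))
  where
  e₁ : ∀ y → 2 * (2 * y) + 3 + 2 ≡ 4 * (1 + y) + 1
  e₁ = solve-∀
  e₂ : ∀ m → 2 * (2 * (2 * m)) ≡ 4 * (2 * m)
  e₂ = solve-∀
  e₃ : ∀ y → 4 * (1 + y) + 4 ≡ 2 * (2 * y) + 8
  e₃ = solve-∀

fits-16 : ∀ {y m} r → 2 * (2 * (2 * y)) + 8 + suc r ≤ 2 * (2 * (2 * m)) →
          2 * (2 * (2 * y)) + 16 ≤ 2 * (2 * (2 * m))
fits-16 {y} {m} r fits =
  subst₂ _≤_ (e₃ y) (sym (e₂ m)) (round-up 8 {1 + y} {m} (subst₂ _≤_ (e₁ y r) (e₂ m) fits))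
  where
  e₁ : ∀ y r → 2 * (2 * (2 * y)) + 8 + suc r ≡ 8 * (1 + y) + suc r
  e₁ = solve-∀
  e₂ : ∀ m → 2 * (2 * (2 * m)) ≡ 8 * m
  e₂ = solve-∀
  e₃ : ∀ y → 8 * (1 + y) + 8 ≡ 2 * (2 * (2 * y)) + 16
  e₃ = solve-∀

-- The second half ab of baab at 2v starts inside the prefix unless 1 + v = K, which the letters rule out.
fits-baab : ∀ {v K} → t (1 + v) ≡ a → t K ≡ b → 2 * v + 2 ≤ 2 * K → 2 * v + 4 ≤ 2 * K
fits-baab {v} {K} t1+v tK fits =
  subst (_≤ 2 * K) (position₂ v)
        (*-monoʳ-≤ 2 (≤∧≢⇒< (*-cancelˡ-≤ 2 (subst (_≤ 2 * K) (position₁ v) fits)) 1+v≢K))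
  where
  position₁ : ∀ v → 2 * v + 2 ≡ 2 * (1 + v)
  position₁ = solve-∀
  position₂ : ∀ v → 2 * (2 + v) ≡ 2 * v + 4
  position₂ = solve-∀
  1+v≢K : 1 + v ≢ K
  1+v≢K 1+v≡K = a≢b (trans (sym t1+v) (trans (cong t 1+v≡K) tK))

ba-⊆ : ∀ {m} → t (2 * (2 * m)) ≡ b → let M = 2 * (2 * (2 * m)) in
       Occurrences 1ℙ 2 M ⊆ ((Occurrences 1ℙ 4 M ∪ (Occurrences 0ℙ 4 M ⊕ 2)) ∪ (Occurrences 1ℙ 8 M ⊕ 3))
ba-⊆ {m} tK {suc q} (fits , ba) = extend (ba-position ba) fits
  where
  M : ℕ
  M = 2 * (2 * (2 * m))
  extend : ∀ {q} → BaPosition q → q + 2 ≤ M →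
           ((Occurrences 1ℙ 4 M ∪ (Occurrences 0ℙ 4 M ⊕ 2)) ∪ (Occurrences 1ℙ 8 M ⊕ 3)) (suc q)
  extend (in-baab v ba) fits =
    inj₁ (inj₁ (fits-baab {v} {2 * (2 * m)} (proj₂ (letters₂ ba)) tK fits , occurrence-double ba))
  extend (in-abba y a-at-y) fits =
    inj₁ (inj₂ (suc (2 * (2 * y)) ,
                (subst (_≤ M) (+-assoc _ 2 2) fits , occurrence-double (occurrence-double a-at-y)) , refl))
  extend (in-baababba y ba) fits =
    inj₂ (suc (2 * (2 * y)) , (fits-8 {y} {m} fits , occurrence-double (occurrence-double ba)) , refl)

baab-abba-⊇ : ∀ {M} → ((Occurrences 0ℙ 16 M ⊕ 8) ∪ (Occurrences 1ℙ 16 M ⊕ 6)) ⊆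
                      (Occurrences 1ℙ 4 M ∩ (Occurrences 0ℙ 4 M ⊕ 2))
baab-abba-⊇ (inj₁ p∈A) =
  Occurrences-inside (from-yes (occurrence? 1ℙ 4 8)) (from-yes (12 ≤? 16)) p∈A ,
  ⊕-mono (Occurrences-inside (from-yes (occurrence? 0ℙ 4 6)) (from-yes (10 ≤? 16))) (⊕-+ {m = 6} p∈A)
baab-abba-⊇ (inj₂ p∈B) =
  Occurrences-inside (from-yes (occurrence? 0ℙ 4 6)) (from-yes (10 ≤? 16)) p∈B ,
  ⊕-mono (Occurrences-inside (from-yes (occurrence? 1ℙ 4 4)) (from-yes (8 ≤? 16))) (⊕-+ {m = 4} p∈B)

baab-abba-⊆ : ∀ {m} → let M = 2 * (2 * (2 * m)) in
              (Occurrences 1ℙ 4 M ∩ (Occurrences 0ℙ 4 M ⊕ 2)) ⊆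
              ((Occurrences 0ℙ 16 M ⊕ 8) ∪ (Occurrences 1ℙ 16 M ⊕ 6))
baab-abba-⊆ {x = zero} ((() , _))
baab-abba-⊆ {x = suc _} (_ , (zero , () , _))
baab-abba-⊆ {m} {suc _} ((fits , baab) , (suc x , (_ , abba) , refl)) = extend (abba-baab-position abba baab) fits
  where
  M : ℕ
  M = 2 * (2 * (2 * m))
  extend : ∀ {x} → AbbaBaabPosition x → x + 2 + 4 ≤ M →
           ((Occurrences 0ℙ 16 M ⊕ 8) ∪ (Occurrences 1ℙ 16 M ⊕ 6)) (suc (x + 2))
  extend (in-complemented y ba) fits =
    inj₂ (suc (2 * (2 * (2 * y))) ,
          (fits-16 {y} {m} 1 (subst (_≤ M) (offset y) fits) ,
           occurrence-double (occurrence-double (occurrence-double ba))) ,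
          cong suc (+-assoc _ 4 2))
    where
    offset : ∀ y → 2 * (2 * (2 * y)) + 4 + 2 + 4 ≡ 2 * (2 * (2 * y)) + 8 + 2
    offset = solve-∀
  extend (in-plain y ab) fits =
    inj₁ (suc (2 * (2 * (2 * y))) ,
          (fits-16 {y} {m} 3 (subst (_≤ M) (offset y) fits) ,
           occurrence-double (occurrence-double (occurrence-double ab))) ,
          cong suc (+-assoc _ 6 2))
    where
    offset : ∀ y → 2 * (2 * (2 * y)) + 6 + 2 + 4 ≡ 2 * (2 * (2 * y)) + 8 + 4
    offset = solve-∀

baab-baababba-disjoint : ∀ {M} → (Occurrences 1ℙ 4 M ∩ (Occurrences 1ℙ 8 M ⊕ 3)) ≐ ∅
baab-baababba-disjoint = clash , λ ()
  where
  clash : ∀ {M p} → (Occurrences 1ℙ 4 M ∩ (Occurrences 1ℙ 8 M ⊕ 3)) p → ⊥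
  clash {p = zero} (() , _)
  clash {p = suc _} (_ , (zero , () , _))
  clash {p = suc _} ((_ , baab) , (suc x , (_ , baababba) , refl)) =
    a≢b (occurrences-agree baab baababba 2 5 (from-yes (2 <? 4)) (from-yes (5 <? 8)) (+-assoc x 3 2))

abba-baababba-disjoint : ∀ {M} → ((Occurrences 0ℙ 4 M ⊕ 2) ∩ (Occurrences 1ℙ 8 M ⊕ 3)) ≐ ∅
abba-baababba-disjoint = clash , λ ()
  where
  clash : ∀ {M p} → ((Occurrences 0ℙ 4 M ⊕ 2) ∩ (Occurrences 1ℙ 8 M ⊕ 3)) p → ⊥
  clash ((zero , () , _) , _)
  clash (_ , (zero , () , _))
  clash ((suc x′ , (_ , abba) , refl) , (suc x , (_ , baababba) , e)) =
    a≢b (sym (occurrences-agree abba baababba 1 2 (from-yes (1 <? 4)) (from-yes (2 <? 8)) x′+1≡x+2))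
    where
    x′+1≡x+2 : x′ + 1 ≡ x + 2
    x′+1≡x+2 =
      +-cancelʳ-≡ 1 (x′ + 1) (x + 2) (trans (+-assoc x′ 1 1) (trans (suc-injective e) (sym (+-assoc x 2 1))))

-- At scale n the patterns have lengths 2^(1+n+d), as A_{i,j-d} and B_{i,j-d} do when i - j = 2 + n.
Scaled : ℕ → ℕ → Parity → ℕ → Pred ℕ 0ℓ
Scaled n M p d = Occurrences p (2 ^ (1 + n + d)) M

ScaledIntersection : ℕ → ℕ → Pred ℕ 0ℓ
ScaledIntersection n M =
  (Scaled n M 0ℙ 3 ⊕ (2 ^ (1 + n + 2))) ∪ (Scaled n M 1ℙ 3 ⊕ (2 ^ (1 + n + 1) + 2 ^ (1 + n)))

ScaledRecurrence : ℕ → ℕ → Set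
ScaledRecurrence n M = Recurrence (Scaled n M) (ScaledIntersection n M) (2 ^ (1 + n)) (2 ^ (1 + n) + 2 ^ n)

recurrence-base : ∀ m → t (2 * (2 * m)) ≡ b → ScaledRecurrence 0 (2 * (2 * (2 * m)))
recurrence-base m tK = record
  { union        = ba-⊆ {m} tK , ba-⊇
  ; intersection = baab-abba-⊆ {m} , baab-abba-⊇
  ; disjoint₁    = baab-baababba-disjoint
  ; disjoint₂    = abba-baababba-disjoint
  }

Scaled-double : ∀ n M p d → Doubled (Scaled n M p d) ≐ Scaled (suc n) (2 * M) p d
Scaled-double n M p d = ≐-sym (Occurrences-double (*-monoʳ-≤ 2 (m^n>0 2 (n + d))))

ScaledIntersection-double : ∀ n M → Doubled (ScaledIntersection n M) ≐ ScaledIntersection (suc n) (2 * M)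
ScaledIntersection-double n M =
  ≐-trans Doubled-∪ (∪-cong (≐-trans (Doubled-⊕ λ ()) (⊕-cong (Scaled-double n M 0ℙ 3)))
                            (≐-trans (Doubled-⊕ λ ()) (≐-trans (⊕-cong (Scaled-double n M 1ℙ 3))
                                                               (⊕-≡ (*-distribˡ-+ 2 (2 ^ (1 + n + 1)) (2 ^ (1 + n)))))))

scaled-recurrence : ∀ n e → ScaledRecurrence n (2 ^ (n + (3 + e)))
scaled-recurrence zero    e = recurrence-base (2 ^ e) (t-2^ (2 + e))
scaled-recurrence (suc n) e =
  subst (Recurrence _ _ _) (*-distribˡ-+ 2 (2 ^ (1 + n)) (2 ^ n))
        (Recurrence-cong (λ p d _ → Scaled-double n M p d) (ScaledIntersection-double n M)
                         (Recurrence-Doubled (λ _ _ ()) (scaled-recurrence n e)))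
  where
  M : ℕ
  M = 2 ^ (n + (3 + e))

-- Back to the words T_i

module _ {A : Set} where

  applyUpTo-++ : ∀ (f : ℕ → A) m n → applyUpTo f (m + n) ≡ applyUpTo f m ++ applyUpTo (f ∘ (m +_)) n
  applyUpTo-++ f zero    n = refl
  applyUpTo-++ f (suc m) n = cong (f 0 ∷_) (applyUpTo-++ (f ∘ suc) m n)

  applyUpTo-cong : ∀ {f g : ℕ → A} n → (∀ r → r < n → f r ≡ g r) → applyUpTo f n ≡ applyUpTo g n
  applyUpTo-cong zero    f≡g = refl
  applyUpTo-cong (suc n) f≡g = cong₂ _∷_ (f≡g 0 (s≤s z≤n)) (applyUpTo-cong n λ r r<n → f≡g (suc r) (s≤s r<n))

  applyUpTo-prefix : ∀ (f g : ℕ → A) M L y → applyUpTo f M ≡ applyUpTo g L ++ y →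
                     L ≤ M × (∀ r → r < L → f r ≡ g r)
  applyUpTo-prefix f g M       zero    y _ = z≤n , λ _ ()
  applyUpTo-prefix f g zero    (suc L) y ()
  applyUpTo-prefix f g (suc M) (suc L) y e with ∷-injective e
  ... | f0≡g0 , rest with applyUpTo-prefix (f ∘ suc) (g ∘ suc) M L y rest
  ...   | L≤M , agree = s≤s L≤M , λ where
    zero    _         → f0≡g0
    (suc r) (s≤s r<L) → agree r r<L

  applyUpTo-factor : ∀ (f g : ℕ → A) M L x y → applyUpTo f M ≡ x ++ applyUpTo g L ++ y →
                     length x + L ≤ M × (∀ r → r < L → f (length x + r) ≡ g r)
  applyUpTo-factor f g M       L []      y e = applyUpTo-prefix f g M L y e
  applyUpTo-factor f g zero    L (_ ∷ x) y ()
  applyUpTo-factor f g (suc M) L (_ ∷ x) y e with applyUpTo-factor (f ∘ suc) g M L x y (∷-injectiveʳ e)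
  ... | fits , agree = s≤s fits , agree

Occ-applyUpTo : ∀ p L M → Occ (applyUpTo (flipBy p ∘ t) L) (applyUpTo t M) ≐ Occurrences p L M
Occ-applyUpTo p L M = to , from
  where
  to : Occ (applyUpTo (flipBy p ∘ t) L) (applyUpTo t M) ⊆ Occurrences p L M
  to {suc q} (x , y , refl , e) with applyUpTo-factor t (flipBy p ∘ t) M L x y e
  ... | fits , agree = fits , occurrence agree
  from : Occurrences p L M ⊆ Occ (applyUpTo (flipBy p ∘ t) L) (applyUpTo t M)
  from {suc q} (fits , o) =
    applyUpTo t q , applyUpTo (λ r → t (q + (L + r))) R , length-applyUpTo t q , (begin
      applyUpTo t M
        ≡⟨ cong (applyUpTo t) M≡q+[L+R] ⟩
      applyUpTo t (q + (L + R))
        ≡⟨ applyUpTo-++ t q (L + R) ⟩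
      applyUpTo t q ++ applyUpTo (t ∘ (q +_)) (L + R)
        ≡⟨ cong (applyUpTo t q ++_) (applyUpTo-++ (t ∘ (q +_)) L R) ⟩
      applyUpTo t q ++ applyUpTo (t ∘ (q +_)) L ++ applyUpTo (λ r → t (q + (L + r))) R
        ≡⟨ cong (λ w → applyUpTo t q ++ w ++ _) (applyUpTo-cong L (letter o)) ⟩
      applyUpTo t q ++ applyUpTo (flipBy p ∘ t) L ++ applyUpTo (λ r → t (q + (L + r))) R ∎)
    where
    R : ℕ
    R = M ∸ (q + L)
    M≡q+[L+R] : M ≡ q + (L + R)
    M≡q+[L+R] = trans (sym (m+[n∸m]≡n fits)) (+-assoc q L R)

T-applyUpTo : ∀ n → T (suc n) ≡ applyUpTo t (2 ^ n)
T-applyUpTo zero    = refl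
T-applyUpTo (suc n) = begin
  T (suc n) ++ bar (T (suc n))                 ≡⟨ cong (λ w → w ++ bar w) (T-applyUpTo n) ⟩
  applyUpTo t N ++ bar (applyUpTo t N)         ≡⟨ cong (applyUpTo t N ++_) (map-applyUpTo t flip N) ⟩
  applyUpTo t N ++ applyUpTo (flip ∘ t) N      ≡⟨ cong (applyUpTo t N ++_) (applyUpTo-cong N second-half) ⟩
  applyUpTo t N ++ applyUpTo (t ∘ (N +_)) N    ≡⟨ applyUpTo-++ t N N ⟨
  applyUpTo t (N + N)                          ≡⟨ cong (λ m → applyUpTo t (N + m)) (+-identityʳ N) ⟨
  applyUpTo t (2 * N)                          ∎
  where
  N : ℕ
  N = 2 ^ n
  second-half : ∀ r → r < N → flip (t r) ≡ t (N + r)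
  second-half r r<N = sym (letter (occurrence-2^ n) r r<N)

barBy : Parity → List Letter → List Letter
barBy 0ℙ w = w
barBy 1ℙ w = bar w

AB : Parity → ℕ → ℕ → Pred ℕ 0ℓ
AB p i k = Occ (barBy p (T (i ∸ k))) (T i)

barBy-applyUpTo : ∀ p n → barBy p (T (suc n)) ≡ applyUpTo (flipBy p ∘ t) (2 ^ n)
barBy-applyUpTo 0ℙ n = T-applyUpTo n
barBy-applyUpTo 1ℙ n = trans (cong bar (T-applyUpTo n)) (map-applyUpTo t flip (2 ^ n))

Occ-Occurrences : ∀ p k n → Occ (barBy p (T (suc k))) (T (suc n)) ≐ Occurrences p (2 ^ k) (2 ^ n)
Occ-Occurrences p k n rewrite barBy-applyUpTo p k | T-applyUpTo n = Occ-applyUpTo p (2 ^ k) (2 ^ n)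

j+[2+n]∸[j∸d]≡2+[n+d] : ∀ {j d} n → d ≤ j → (j + (2 + n)) ∸ (j ∸ d) ≡ 2 + (n + d)
j+[2+n]∸[j∸d]≡2+[n+d] {j} {d} n d≤j = begin
  (j + (2 + n)) ∸ (j ∸ d)    ≡⟨ +-∸-comm (2 + n) (m∸n≤m j d) ⟩
  (j ∸ (j ∸ d)) + (2 + n)    ≡⟨ cong (_+ (2 + n)) (m∸[m∸n]≡n d≤j) ⟩
  d + (2 + n)                ≡⟨ rearrange d n ⟩
  2 + (n + d)                ∎
  where
  rearrange : ∀ d n → d + (2 + n) ≡ 2 + (n + d)
  rearrange = solve-∀

i≡j+[2+n] : ∀ {i j} → j + 2 ≤ i → ∃[ n ] i ≡ j + (2 + n)
i≡j+[2+n] {j = j} j+2≤i with m≤n⇒∃[o]m+o≡n j+2≤i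
... | n , j+2+n≡i = n , trans (sym j+2+n≡i) (+-assoc j 2 n)

Scaled≐AB : ∀ p {j d} n → 2 ≤ j → d ≤ j → Scaled n (τ (j + (2 + n))) p d ≐ AB p (j + (2 + n)) (j ∸ d)
Scaled≐AB p {suc (suc j₀)} {d} n (s≤s (s≤s z≤n)) d≤j =
  subst (λ k → Scaled n (τ i) p d ≐ Occ (barBy p (T k)) (T i)) (sym (j+[2+n]∸[j∸d]≡2+[n+d] n d≤j))
        (≐-sym (Occ-Occurrences p (suc (n + d)) (suc (j₀ + (2 + n)))))
  where
  i : ℕ
  i = suc (suc j₀) + (2 + n)

scaled-recurrence-in-T : ∀ {j} n → 2 ≤ j → ScaledRecurrence n (τ (j + (2 + n)))
scaled-recurrence-in-T {suc (suc j₀)} n (s≤s (s≤s z≤n)) =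
  subst (ScaledRecurrence n) (cong (2 ^_) (exponent n j₀)) (scaled-recurrence n j₀)
  where
  exponent : ∀ n j₀ → n + (3 + j₀) ≡ suc (j₀ + (2 + n))
  exponent = solve-∀

recurrence-in-T : ∀ {i j} → 2 ≤ j → j + 2 ≤ i →
                  Recurrence (λ p d → AB p i (j ∸ d)) (ScaledIntersection (i ∸ (j + 2)) (τ i))
                             (τ (i ∸ j)) (τ (i ∸ j) + τ (i ∸ (j + 1)))
recurrence-in-T {j = j} 2≤j j+2≤i with i≡j+[2+n] j+2≤i
... | n , refl rewrite [m+n]∸[m+o]≡n∸o j (2 + n) 2 | m+n∸m≡n j (2 + n) | [m+n]∸[m+o]≡n∸o j (2 + n) 1 =
  Recurrence-cong (λ p d d≤2 → Scaled≐AB p n 2≤j (≤-trans d≤2 2≤j)) ≐-refl (scaled-recurrence-in-T n 2≤j)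

ScaledIntersection-vanishes : ∀ {i j} → 2 ≡ j → j + 2 ≤ i → ScaledIntersection (i ∸ (j + 2)) (τ i) ≐ ∅
ScaledIntersection-vanishes {suc (suc (suc (suc n)))} refl (s≤s (s≤s (s≤s (s≤s _)))) = (λ where
    (inj₁ (_ , p∈A , _)) → proj₁ (Occurrences-too-long long) p∈A
    (inj₂ (_ , p∈B , _)) → proj₁ (Occurrences-too-long long) p∈B) , λ ()
  where
  long : 2 ^ (3 + n) < 2 ^ (1 + n + 3)
  long = ^-monoʳ-< 2 (s≤s (s≤s z≤n)) (s≤s (≤-reflexive (+-comm 3 n)))

ScaledIntersection-in-T : ∀ {i j} → 3 ≤ j → j + 2 ≤ i →
  ScaledIntersection (i ∸ (j + 2)) (τ i) ≐
  ((A i (j ∸ 3) ⊕ τ (i ∸ (j ∸ 2))) ∪ (B i (j ∸ 3) ⊕ (τ (i ∸ (j ∸ 1)) + τ (i ∸ j))))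
ScaledIntersection-in-T {j = j} 3≤j j+2≤i with i≡j+[2+n] j+2≤i
... | n , refl rewrite [m+n]∸[m+o]≡n∸o j (2 + n) 2 | m+n∸m≡n j (2 + n)
                     | j+[2+n]∸[j∸d]≡2+[n+d] {j} {2} n (<⇒≤ 3≤j)
                     | j+[2+n]∸[j∸d]≡2+[n+d] {j} {1} n (<⇒≤ (<⇒≤ 3≤j)) =
  ∪-cong (⊕-cong (Scaled≐AB 0ℙ n (<⇒≤ 3≤j) 3≤j)) (⊕-cong (Scaled≐AB 1ℙ n (<⇒≤ 3≤j) 3≤j))

B-whole-empty : ∀ {i} → 2 ≤ i → B i 0 ≐ ∅
B-whole-empty {suc (suc n)} (s≤s (s≤s z≤n)) =
  ≐-trans (Occ-Occurrences 1ℙ (suc n) (suc n)) (Occurrences-whole (m^n>0 2 (suc n)))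

B-half-singleton : ∀ {i} → 2 ≤ i → B i 1 ≐ ｛ τ (i ∸ 1) + 1 ｝
B-half-singleton {suc (suc n)} (s≤s (s≤s z≤n)) = ≐-trans (Occ-Occurrences 1ℙ n (suc n)) (Occurrences-middle n)

corollary19 : ∀ (i : ℕ) → 2 ≤ i →
    (B i 0 ≐ ∅)
  × (B i 1 ≐ ｛ τ (i ∸ 1) + 1 ｝)
  × (∀ (j : ℕ) → 2 ≤ j → j + 2 ≤ i →
        let A″₁ = A i (j ∸ 1) ⊕ τ (i ∸ j)
            B″₂ = B i (j ∸ 2) ⊕ (τ (i ∸ j) + τ (i ∸ (j + 1)))
            I′₃ = (A i (j ∸ 3) ⊕ τ (i ∸ (j ∸ 2)))
                    ∪ (B i (j ∸ 3) ⊕ (τ (i ∸ (j ∸ 1)) + τ (i ∸ j)))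
        in (B i j ≐ ((B i (j ∸ 1) ∪ A″₁) ∪ B″₂))
         × ((2 ≡ j → (B i (j ∸ 1) ∩ A″₁) ≐ ∅)
            × (3 ≤ j → (B i (j ∸ 1) ∩ A″₁) ≐ I′₃))
         × ((B i (j ∸ 1) ∩ B″₂) ≐ ∅)
         × ((A″₁ ∩ B″₂) ≐ ∅))
corollary19 i 2≤i = B-whole-empty 2≤i , B-half-singleton 2≤i , λ j 2≤j j+2≤i →
  let open Recurrence (recurrence-in-T 2≤j j+2≤i) in
    union
  , ( (λ 2≡j → ≐-trans intersection (ScaledIntersection-vanishes 2≡j j+2≤i))
    , (λ 3≤j → ≐-trans intersection (ScaledIntersection-in-T 3≤j j+2≤i)))
  , disjoint₁
  , disjoint₂
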